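{- The distinguishing number of the folded hypercube $FQ_n$ is $\dist(FQ_n)=2$ if $n=1$; $4$ if $n=2$; $5$ if $n=3$; and $2$ if $n\ge 4$.
   Context: The folded hypercube $FQ_n$ has vertex set $\mathbb{Z}_2^n$, two vertices being adjacent iff they differ in exactly one position or in all $n$ positions. A vertex coloring is distinguishing if the only automorphism preserving every color class is the identity; $\dist(G)$ is the minimum number of colors in a distinguishing coloring of $G$. -}

module Defs where

open import Data.Nat using (ℕ; zero; suc; _<_; _+_)
open import Data.Bool using (Bool; true; false; if_then_else_; _xor_)
open import Data.Vec using (Vec; []; _∷_)
open import Data.Fin using (Fin)
open import Data.Sum using (_⊎_)
open import Data.Product using (_×_; Σ)
open import Relation.Nullary using (¬_)
open import Relation.Binary.PropositionalEquality using (_≡_)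
open import Function.Bundles using (_⇔_)

V : ℕ → Set
V n = Vec Bool n

hamming : ∀ {n} → V n → V n → ℕ
hamming [] [] = 0
hamming (x ∷ xs) (y ∷ ys) = (if x xor y then 1 else 0) + hamming xs ys

Adj : (n : ℕ) → V n → V n → Set
Adj n u v = hamming u v ≡ 1 ⊎ hamming u v ≡ n

record Automorphism (n : ℕ) : Set where
  field
    to       : V n → V n
    from     : V n → V n
    to-from  : ∀ v → to (from v) ≡ v
    from-to  : ∀ v → from (to v) ≡ v
    adj      : ∀ u v → Adj n u v ⇔ Adj n (to u) (to v)
open Automorphism public

Distinguishing : (n k : ℕ) → (V n → Fin k) → Set
Distinguishing n k c =
  (σ : Automorphism n) → (∀ v → c (to σ v) ≡ c v) → ∀ v → to σ v ≡ v

DistNumber : (n k : ℕ) → Set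
DistNumber n k =
  Σ (V n → Fin k) (Distinguishing n k)
  × (∀ m → m < k → (c : V n → Fin m) → ¬ Distinguishing n m c)

-- For n ≤ 2, FQ_n is the complete graph on 2ⁿ vertices.  For n = 3 it is K₄,₄
-- between the two parity classes: two equally coloured vertices of one class can
-- be swapped, and with at most four colours each class uses every colour once,
-- so the classes can be exchanged colour by colour; giving ones a fifth colour
-- of its own makes the parity classes, and then every vertex, visible.
--
-- For n ≥ 4 the complement of a vertex is never a common neighbour of two
-- vertices at distance 2, so these have just their two hypercube common
-- neighbours, and an automorphism fixing a vertex and its n hypercube
-- neighbours fixes everything.  Mark zeros, ones, e₀, …, e_{n-2} and
-- e₀ + e₁, …, e_{n-2} + e_{n-1}.  Then zeros is the only marked vertex with four
-- marked neighbours, e₀ is the only marked neighbour of zeros with exactly two,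
-- and from there eᵢ + eᵢ₊₁ and eᵢ₊₁ are fixed one after the other.  One colour
-- never suffices since complementation is an automorphism.

module Submission where

open import Defs
open import Data.Bool using (Bool; true; false; not; _xor_; if_then_else_)
open import Data.Bool.Properties
  using ( not-involutive; not-distribˡ-xor; not-distribʳ-xor; xor-annihilates-not
        ; xor-assoc; xor-same; xor-identityʳ)
  renaming (_≟_ to _≟ᵇ_)
open import Data.Empty using (⊥; ⊥-elim)
open import Data.Fin using (Fin; zero; suc; fromℕ; inject₁; punchOut; combine; remQuot)
import Data.Fin.Properties as Fin
open import Data.Fin.Properties using (combine-injective; combine-remQuot)
open import Data.List as List using (List; []; _∷_; length; lookup)
open import Data.List.Membership.Propositional using (_∈_)
open import Data.List.Membership.Propositional.Properties using (∈-lookup; ∈-map⁻)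
import Data.List.Membership.Setoid.Properties as Membership
open import Data.List.Relation.Unary.All as All using (All; []; _∷_)
open import Data.List.Relation.Unary.AllPairs using ([]; _∷_)
open import Data.List.Relation.Unary.Any as Any using (here; there)
open import Data.List.Relation.Unary.Unique.Propositional using (Unique)
import Data.List.Relation.Unary.Unique.Propositional.Properties as Uniqueₚ
open import Data.List.Properties using (length-map)
open import Data.Nat using (ℕ; zero; suc; _+_; _^_; _≤_; _<_; z≤n; s≤s; _≟_)
open import Data.Nat.Properties
  using ( +-suc; +-comm; suc-injective; ≤-refl; ≤-trans; ≤-antisym; ≤-pred; m≤n⇒m≤1+n
        ; <-irrefl; <-trans; <⇒≢; ≮⇒≥; n<1+n; m+1+n≢m; anyUpTo?)
open import Data.Product using (_×_; _,_; ∃; proj₁; proj₂)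
open import Data.Sum using (_⊎_; inj₁; inj₂)
open import Data.Vec using ([]; _∷_; replicate; map; tail)
open import Data.Vec.Properties using (≡-dec)
open import Function using (_∘_; case_of_)
open import Function.Bundles using (_⇔_; mk⇔; Equivalence)
open import Function.Construct.Composition using (_⇔-∘_)
open import Function.Construct.Symmetry using (⇔-sym)
open import Relation.Nullary using (¬_; Dec; yes; no)
open import Relation.Nullary.Decidable using (_⊎-dec_)
open import Relation.Binary.PropositionalEquality
  using (_≡_; _≢_; refl; sym; trans; cong; cong₂; subst; subst₂; ≢-sym; setoid; module ≡-Reasoning)

_≟ⱽ_ : ∀ {n} (u v : V n) → Dec (u ≡ v)
_≟ⱽ_ = ≡-dec _≟ᵇ_

zeros ones : ∀ {n} → V n
zeros = replicate _ false
ones  = replicate _ true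

complement : ∀ {n} → V n → V n
complement = map not

-- Bit positions are natural numbers: flipping out of range does nothing and
-- reading out of range gives false.
flipBit : ∀ {n} → ℕ → V n → V n
flipBit _       []       = []
flipBit zero    (x ∷ xs) = not x ∷ xs
flipBit (suc i) (x ∷ xs) = x ∷ flipBit i xs

bit : ∀ {n} → V n → ℕ → Bool
bit []       _       = false
bit (x ∷ xs) zero    = x
bit (x ∷ xs) (suc i) = bit xs i

weight : ∀ {n} → V n → ℕ
weight []       = 0
weight (x ∷ xs) = (if x then 1 else 0) + weight xs

unit : ∀ {n} → ℕ → V n
unit i = flipBit i zeros

not-≢ : ∀ b → not b ≢ b
not-≢ true  ()
not-≢ false ()

complement-involutive : ∀ {n} (v : V n) → complement (complement v) ≡ v
complement-involutive []       = refl
complement-involutive (x ∷ xs) = cong₂ _∷_ (not-involutive x) (complement-involutive xs)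

complement-zeros : ∀ {n} → complement (zeros {n}) ≡ ones
complement-zeros {zero}  = refl
complement-zeros {suc n} = cong (true ∷_) complement-zeros

complement-ones : ∀ {n} → complement (ones {n}) ≡ zeros
complement-ones {zero}  = refl
complement-ones {suc n} = cong (false ∷_) complement-ones

flipBit-involutive : ∀ {n} i (v : V n) → flipBit i (flipBit i v) ≡ v
flipBit-involutive _       []       = refl
flipBit-involutive zero    (x ∷ xs) = cong (_∷ xs) (not-involutive x)
flipBit-involutive (suc i) (x ∷ xs) = cong (x ∷_) (flipBit-involutive i xs)

flipBit-comm : ∀ {n} i j (v : V n) → flipBit i (flipBit j v) ≡ flipBit j (flipBit i v)
flipBit-comm _       _       []       = refl
flipBit-comm zero    zero    (x ∷ xs) = refl
flipBit-comm zero    (suc j) (x ∷ xs) = refl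
flipBit-comm (suc i) zero    (x ∷ xs) = refl
flipBit-comm (suc i) (suc j) (x ∷ xs) = cong (x ∷_) (flipBit-comm i j xs)

flipBit-injective : ∀ {n} i {u v : V n} → flipBit i u ≡ flipBit i v → u ≡ v
flipBit-injective i {u} {v} eq =
  trans (sym (flipBit-involutive i u)) (trans (cong (flipBit i) eq) (flipBit-involutive i v))

bit-flipBit : ∀ {n} i (v : V n) → i < n → bit (flipBit i v) i ≡ not (bit v i)
bit-flipBit zero    (x ∷ xs) _         = refl
bit-flipBit (suc i) (x ∷ xs) (s≤s i<n) = bit-flipBit i xs i<n

bit-flipBit-≢ : ∀ {n} i j (v : V n) → i ≢ j → bit (flipBit i v) j ≡ bit v j
bit-flipBit-≢ _       _       []       _   = refl
bit-flipBit-≢ zero    zero    (x ∷ xs) i≢j = ⊥-elim (i≢j refl)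
bit-flipBit-≢ zero    (suc j) (x ∷ xs) _   = refl
bit-flipBit-≢ (suc i) zero    (x ∷ xs) _   = refl
bit-flipBit-≢ (suc i) (suc j) (x ∷ xs) i≢j = bit-flipBit-≢ i j xs (λ i≡j → i≢j (cong suc i≡j))

bit-zeros : ∀ {n} i → bit (zeros {n}) i ≡ false
bit-zeros {zero}  _       = refl
bit-zeros {suc n} zero    = refl
bit-zeros {suc n} (suc i) = bit-zeros {n} i

bit-ones : ∀ {n} i → i < n → bit (ones {n}) i ≡ true
bit-ones {suc n} zero    _         = refl
bit-ones {suc n} (suc i) (s≤s i<n) = bit-ones {n} i i<n

flipBit-flipBit-≢ : ∀ {n} i j (v : V n) → i < n → i ≢ j → flipBit i (flipBit j v) ≢ v
flipBit-flipBit-≢ i j v i<n i≢j eq = not-≢ (bit v i) (begin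
  not (bit v i)                   ≡⟨ cong not (bit-flipBit-≢ j i v (λ j≡i → i≢j (sym j≡i))) ⟨
  not (bit (flipBit j v) i)       ≡⟨ bit-flipBit i (flipBit j v) i<n ⟨
  bit (flipBit i (flipBit j v)) i ≡⟨ cong (λ w → bit w i) eq ⟩
  bit v i                         ∎)
  where open ≡-Reasoning

flipBit-injectiveˡ : ∀ {n} i j (v : V n) → i < n → flipBit i v ≡ flipBit j v → i ≡ j
flipBit-injectiveˡ i j v i<n eq with i ≟ j
... | yes i≡j = i≡j
... | no  i≢j = ⊥-elim (not-≢ (bit v i) (begin
  not (bit v i)          ≡⟨ bit-flipBit i v i<n ⟨
  bit (flipBit i v) i    ≡⟨ cong (λ w → bit w i) eq ⟩
  bit (flipBit j v) i    ≡⟨ bit-flipBit-≢ j i v (λ j≡i → i≢j (sym j≡i)) ⟩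
  bit v i                ∎))
  where open ≡-Reasoning

weight-flipBit-false : ∀ {n} i (v : V n) → i < n → bit v i ≡ false → weight (flipBit i v) ≡ suc (weight v)
weight-flipBit-false zero    (false ∷ xs) _         _ = refl
weight-flipBit-false (suc i) (true  ∷ xs) (s≤s i<n) b = cong suc (weight-flipBit-false i xs i<n b)
weight-flipBit-false (suc i) (false ∷ xs) (s≤s i<n) b = weight-flipBit-false i xs i<n b

weight-flipBit-true : ∀ {n} i (v : V n) → i < n → bit v i ≡ true → suc (weight (flipBit i v)) ≡ weight v
weight-flipBit-true zero    (true  ∷ xs) _         _ = refl
weight-flipBit-true (suc i) (true  ∷ xs) (s≤s i<n) b = cong suc (weight-flipBit-true i xs i<n b)
weight-flipBit-true (suc i) (false ∷ xs) (s≤s i<n) b = weight-flipBit-true i xs i<n b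

weight-complement : ∀ {n} (v : V n) → weight (complement v) + weight v ≡ n
weight-complement []           = refl
weight-complement (false ∷ xs) = cong suc (weight-complement xs)
weight-complement (true  ∷ xs) =
  trans (+-suc (weight (complement xs)) (weight xs)) (cong suc (weight-complement xs))

weight-zeros : ∀ {n} → weight (zeros {n}) ≡ 0
weight-zeros {zero}  = refl
weight-zeros {suc n} = weight-zeros {n}

weight-ones : ∀ {n} → weight (ones {n}) ≡ n
weight-ones {zero}  = refl
weight-ones {suc n} = cong suc (weight-ones {n})

hamming-self : ∀ {n} (v : V n) → hamming v v ≡ 0
hamming-self []       = refl
hamming-self (x ∷ xs) rewrite xor-same x = hamming-self xs

hamming-sym : ∀ {n} (u v : V n) → hamming u v ≡ hamming v u
hamming-sym []           []           = refl
hamming-sym (true  ∷ xs) (true  ∷ ys) = hamming-sym xs ys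
hamming-sym (false ∷ xs) (false ∷ ys) = hamming-sym xs ys
hamming-sym (true  ∷ xs) (false ∷ ys) = cong suc (hamming-sym xs ys)
hamming-sym (false ∷ xs) (true  ∷ ys) = cong suc (hamming-sym xs ys)

hamming≡0⇒≡ : ∀ {n} (u v : V n) → hamming u v ≡ 0 → u ≡ v
hamming≡0⇒≡ []           []           _  = refl
hamming≡0⇒≡ (true  ∷ xs) (true  ∷ ys) eq = cong (true ∷_) (hamming≡0⇒≡ xs ys eq)
hamming≡0⇒≡ (false ∷ xs) (false ∷ ys) eq = cong (false ∷_) (hamming≡0⇒≡ xs ys eq)

hamming≤n : ∀ {n} (u v : V n) → hamming u v ≤ n
hamming≤n []           []           = z≤n
hamming≤n (true  ∷ xs) (true  ∷ ys) = m≤n⇒m≤1+n (hamming≤n xs ys)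
hamming≤n (false ∷ xs) (false ∷ ys) = m≤n⇒m≤1+n (hamming≤n xs ys)
hamming≤n (true  ∷ xs) (false ∷ ys) = s≤s (hamming≤n xs ys)
hamming≤n (false ∷ xs) (true  ∷ ys) = s≤s (hamming≤n xs ys)

hamming-suc⇒flipBit : ∀ {n} (u v : V n) k → hamming u v ≡ suc k →
                      ∃ λ i → i < n × hamming (flipBit i u) v ≡ k
hamming-suc⇒flipBit [] [] k ()
hamming-suc⇒flipBit (true ∷ xs) (true ∷ ys) k eq with hamming-suc⇒flipBit xs ys k eq
... | i , i<n , eq′ = suc i , s≤s i<n , eq′
hamming-suc⇒flipBit (false ∷ xs) (false ∷ ys) k eq with hamming-suc⇒flipBit xs ys k eq
... | i , i<n , eq′ = suc i , s≤s i<n , eq′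
hamming-suc⇒flipBit (true  ∷ xs) (false ∷ ys) k eq = 0 , s≤s z≤n , suc-injective eq
hamming-suc⇒flipBit (false ∷ xs) (true  ∷ ys) k eq = 0 , s≤s z≤n , suc-injective eq

hamming≡1⇒flipBit : ∀ {n} (u v : V n) → hamming u v ≡ 1 → ∃ λ i → i < n × v ≡ flipBit i u
hamming≡1⇒flipBit u v eq with hamming-suc⇒flipBit u v 0 eq
... | i , i<n , eq′ = i , i<n , sym (hamming≡0⇒≡ (flipBit i u) v eq′)

hamming≡n⇒complement : ∀ {n} (u v : V n) → hamming u v ≡ n → v ≡ complement u
hamming≡n⇒complement []           []           _  = refl
hamming≡n⇒complement (true  ∷ xs) (false ∷ ys) eq =
  cong (false ∷_) (hamming≡n⇒complement xs ys (suc-injective eq))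
hamming≡n⇒complement (false ∷ xs) (true  ∷ ys) eq =
  cong (true ∷_) (hamming≡n⇒complement xs ys (suc-injective eq))
hamming≡n⇒complement (true  ∷ xs) (true  ∷ ys) eq =
  ⊥-elim (<-irrefl refl (subst (_≤ _) eq (hamming≤n xs ys)))
hamming≡n⇒complement (false ∷ xs) (false ∷ ys) eq =
  ⊥-elim (<-irrefl refl (subst (_≤ _) eq (hamming≤n xs ys)))

hamming-flipBit : ∀ {n} i (v : V n) → i < n → hamming v (flipBit i v) ≡ 1
hamming-flipBit zero    (true  ∷ xs) _         = cong suc (hamming-self xs)
hamming-flipBit zero    (false ∷ xs) _         = cong suc (hamming-self xs)
hamming-flipBit (suc i) (true  ∷ xs) (s≤s i<n) = hamming-flipBit i xs i<n
hamming-flipBit (suc i) (false ∷ xs) (s≤s i<n) = hamming-flipBit i xs i<n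

hamming-flipBit-flipBit : ∀ {n} i j (v : V n) → i < n → j < n → i ≢ j →
                          hamming (flipBit i v) (flipBit j v) ≡ 2
hamming-flipBit-flipBit zero zero _ _ _ i≢j = ⊥-elim (i≢j refl)
hamming-flipBit-flipBit zero (suc j) (true  ∷ xs) _ (s≤s j<n) _ = cong suc (hamming-flipBit j xs j<n)
hamming-flipBit-flipBit zero (suc j) (false ∷ xs) _ (s≤s j<n) _ = cong suc (hamming-flipBit j xs j<n)
hamming-flipBit-flipBit (suc i) zero (true  ∷ xs) (s≤s i<n) _ _ =
  cong suc (trans (hamming-sym (flipBit i xs) xs) (hamming-flipBit i xs i<n))
hamming-flipBit-flipBit (suc i) zero (false ∷ xs) (s≤s i<n) _ _ =
  cong suc (trans (hamming-sym (flipBit i xs) xs) (hamming-flipBit i xs i<n))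
hamming-flipBit-flipBit (suc i) (suc j) (x ∷ xs) (s≤s i<n) (s≤s j<n) i≢j rewrite xor-same x =
  hamming-flipBit-flipBit i j xs i<n j<n (λ i≡j → i≢j (cong suc i≡j))

hamming-complement : ∀ {n} (v : V n) → hamming v (complement v) ≡ n
hamming-complement []           = refl
hamming-complement (true  ∷ xs) = cong suc (hamming-complement xs)
hamming-complement (false ∷ xs) = cong suc (hamming-complement xs)

hamming-complementˡ : ∀ {n} (u v : V n) → hamming (complement u) v + hamming u v ≡ n
hamming-complementˡ []           []           = refl
hamming-complementˡ (true  ∷ xs) (true  ∷ ys) = cong suc (hamming-complementˡ xs ys)
hamming-complementˡ (false ∷ xs) (false ∷ ys) = cong suc (hamming-complementˡ xs ys)
hamming-complementˡ (true  ∷ xs) (false ∷ ys) =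
  trans (+-suc (hamming (complement xs) ys) (hamming xs ys)) (cong suc (hamming-complementˡ xs ys))
hamming-complementˡ (false ∷ xs) (true  ∷ ys) =
  trans (+-suc (hamming (complement xs) ys) (hamming xs ys)) (cong suc (hamming-complementˡ xs ys))

hamming-complement-complement : ∀ {n} (u v : V n) → hamming (complement u) (complement v) ≡ hamming u v
hamming-complement-complement []           []           = refl
hamming-complement-complement (true  ∷ xs) (true  ∷ ys) = hamming-complement-complement xs ys
hamming-complement-complement (false ∷ xs) (false ∷ ys) = hamming-complement-complement xs ys
hamming-complement-complement (true  ∷ xs) (false ∷ ys) = cong suc (hamming-complement-complement xs ys)
hamming-complement-complement (false ∷ xs) (true  ∷ ys) = cong suc (hamming-complement-complement xs ys)

Adj-sym : ∀ {n} {u v : V n} → Adj n u v → Adj n v u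
Adj-sym {u = u} {v} (inj₁ eq) = inj₁ (trans (hamming-sym v u) eq)
Adj-sym {u = u} {v} (inj₂ eq) = inj₂ (trans (hamming-sym v u) eq)

Adj-irrefl : ∀ {n} (v : V n) → 1 ≤ n → ¬ Adj n v v
Adj-irrefl v _   (inj₁ eq) with () ← trans (sym (hamming-self v)) eq
Adj-irrefl v 0<n (inj₂ eq) = <⇒≢ 0<n (trans (sym (hamming-self v)) eq)

Adj-flipBit : ∀ {n} i (v : V n) → i < n → Adj n v (flipBit i v)
Adj-flipBit i v i<n = inj₁ (hamming-flipBit i v i<n)

Adj-complement : ∀ {n} (v : V n) → Adj n v (complement v)
Adj-complement v = inj₂ (hamming-complement v)

neighbours : ∀ {n} (u v : V n) → Adj n u v → (∃ λ i → i < n × v ≡ flipBit i u) ⊎ v ≡ complement u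
neighbours u v (inj₁ eq) = inj₁ (hamming≡1⇒flipBit u v eq)
neighbours u v (inj₂ eq) = inj₂ (hamming≡n⇒complement u v eq)

complement-not-Adj : ∀ {n} {u v : V n} → 4 ≤ n → hamming u v ≡ 2 → ¬ Adj n (complement u) v
complement-not-Adj {n} {u} {v} 4≤n h≡2 = λ
  { (inj₁ h′≡1) → <⇒≢ 4≤n (trans (cong (_+ 2) (sym h′≡1)) sum)
  ; (inj₂ h′≡n) → m+1+n≢m n (trans (cong (_+ 2) (sym h′≡n)) sum) }
  where
  sum : hamming (complement u) v + 2 ≡ n
  sum = subst (λ h → hamming (complement u) v + h ≡ n) h≡2 (hamming-complementˡ u v)

flipBit²-collision : ∀ {n} p q i j (u : V n) → p < n → i < n → i ≢ j →
                     flipBit p (flipBit i u) ≡ flipBit q (flipBit j u) → p ≡ i ⊎ p ≡ j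
flipBit²-collision p q i j u p<n i<n i≢j eq with p ≟ i | p ≟ j | q ≟ p
... | yes p≡i | _       | _       = inj₁ p≡i
... | no _    | yes p≡j | _       = inj₂ p≡j
... | no _    | no _    | yes refl =
  ⊥-elim (i≢j (flipBit-injectiveˡ i j u i<n (flipBit-injective q eq)))
... | no p≢i  | no p≢j  | no q≢p  = ⊥-elim (not-≢ (bit u p) (begin
  not (bit u p)                   ≡⟨ cong not (bit-flipBit-≢ i p u (≢-sym p≢i)) ⟨
  not (bit (flipBit i u) p)       ≡⟨ bit-flipBit p (flipBit i u) p<n ⟨
  bit (flipBit p (flipBit i u)) p ≡⟨ cong (λ w → bit w p) eq ⟩
  bit (flipBit q (flipBit j u)) p ≡⟨ bit-flipBit-≢ q p (flipBit j u) q≢p ⟩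
  bit (flipBit j u) p             ≡⟨ bit-flipBit-≢ j p u (≢-sym p≢j) ⟩
  bit u p                         ∎))
  where open ≡-Reasoning

-- For n ≥ 4 a complement is at distance n - 2 ∉ {1, n} from the other vertex,
-- so only the two hypercube common neighbours remain.
common-neighbours : ∀ {n} {x : V n} i j u → 4 ≤ n → i < n → j < n → i ≢ j →
                    Adj n (flipBit i u) x → Adj n (flipBit j u) x →
                    x ≡ u ⊎ x ≡ flipBit i (flipBit j u)
common-neighbours {x = x} i j u 4≤n i<n j<n i≢j adjᵢ adjⱼ
  with neighbours (flipBit i u) x adjᵢ | neighbours (flipBit j u) x adjⱼ
... | inj₂ refl | _ =
  ⊥-elim (complement-not-Adj {u = flipBit i u} 4≤n (hamming-flipBit-flipBit i j u i<n j<n i≢j)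
            (Adj-sym {u = flipBit j u} adjⱼ))
... | inj₁ _ | inj₂ refl =
  ⊥-elim (complement-not-Adj {u = flipBit j u} 4≤n (hamming-flipBit-flipBit j i u j<n i<n (≢-sym i≢j))
            (Adj-sym {u = flipBit i u} adjᵢ))
... | inj₁ (p , p<n , refl) | inj₁ (q , _ , eq) with flipBit²-collision p q i j u p<n i<n i≢j eq
...   | inj₁ refl = inj₁ (flipBit-involutive p u)
...   | inj₂ refl = inj₂ (flipBit-comm p i u)

Fixes : ∀ {n} → Automorphism n → V n → Set
Fixes σ v = to σ v ≡ v

to-injective : ∀ {n} (σ : Automorphism n) {u v} → to σ u ≡ to σ v → u ≡ v
to-injective σ {u} {v} eq = trans (sym (from-to σ u)) (trans (cong (from σ) eq) (from-to σ v))

Adj-to : ∀ {n} (σ : Automorphism n) {u v} → Adj n u v → Adj n (to σ u) (to σ v)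
Adj-to σ {u} {v} = Equivalence.to (adj σ u v)

Adj-to-fixed : ∀ {n} (σ : Automorphism n) {u v} → Fixes σ u → Adj n u v → Adj n u (to σ v)
Adj-to-fixed {n} σ {v = v} fixed a = subst (λ z → Adj n z (to σ v)) fixed (Adj-to σ a)

_⁻¹ : ∀ {n} → Automorphism n → Automorphism n
_⁻¹ {n} σ = record
  { to      = from σ
  ; from    = to σ
  ; to-from = from-to σ
  ; from-to = to-from σ
  ; adj     = λ u v → mk⇔
      (λ a → Equivalence.from (adj σ (from σ u) (from σ v))
               (subst₂ (Adj n) (sym (to-from σ u)) (sym (to-from σ v)) a))
      (λ a → subst₂ (Adj n) (to-from σ u) (to-from σ v)
               (Equivalence.to (adj σ (from σ u) (from σ v)) a))
  }

involution : ∀ {n} (f : V n → V n) → (∀ v → f (f v) ≡ v) →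
             (∀ u v → Adj n u v → Adj n (f u) (f v)) → Automorphism n
involution {n} f f-involutive f-adj = record
  { to      = f
  ; from    = f
  ; to-from = f-involutive
  ; from-to = f-involutive
  ; adj     = λ u v → mk⇔ (f-adj u v)
      (λ a → subst₂ (Adj n) (f-involutive u) (f-involutive v) (f-adj (f u) (f v) a))
  }

complementᴬ : ∀ {n} → Automorphism n
complementᴬ {n} = involution complement complement-involutive λ u v →
  subst (λ h → h ≡ 1 ⊎ h ≡ n) (sym (hamming-complement-complement u v))

-- By common-neighbours, a vertex fixed together with all its hypercube
-- neighbours passes this property on along every hypercube edge.
module _ {n} (σ : Automorphism n) (4≤n : 4 ≤ n) where

  fixes-flipBit-flipBit : ∀ {u} i j → i < n → j < n → i ≢ j →
                          Fixes σ u → Fixes σ (flipBit i u) → Fixes σ (flipBit j u) →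
                          Fixes σ (flipBit i (flipBit j u))
  fixes-flipBit-flipBit {u} i j i<n j<n i≢j fixed fixedᵢ fixedⱼ
    with common-neighbours i j u 4≤n i<n j<n i≢j
           (Adj-to-fixed σ fixedᵢ
             (subst (Adj n (flipBit i u)) (flipBit-comm j i u) (Adj-flipBit j (flipBit i u) j<n)))
           (Adj-to-fixed σ fixedⱼ (Adj-flipBit i (flipBit j u) i<n))
  ... | inj₁ σw≡u = ⊥-elim (flipBit-flipBit-≢ i j u i<n i≢j (to-injective σ (trans σw≡u (sym fixed))))
  ... | inj₂ σw≡w = σw≡w

  FixesStar : V n → Set
  FixesStar u = Fixes σ u × (∀ i → i < n → Fixes σ (flipBit i u))

  fixesStar-flipBit : ∀ {u} j → j < n → FixesStar u → FixesStar (flipBit j u)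
  fixesStar-flipBit {u} j j<n (fixed , fixedₛ) = fixedₛ j j<n , fixes-neighbour
    where
    fixes-neighbour : ∀ i → i < n → Fixes σ (flipBit i (flipBit j u))
    fixes-neighbour i i<n with i ≟ j
    ... | yes refl = subst (Fixes σ) (sym (flipBit-involutive i u)) fixed
    ... | no  i≢j  = fixes-flipBit-flipBit i j i<n j<n i≢j fixed (fixedₛ i i<n) (fixedₛ j j<n)

  fixesStar⇒fixes : ∀ {u} v k → hamming u v ≡ k → FixesStar u → Fixes σ v
  fixesStar⇒fixes {u} v zero    eq star = subst (Fixes σ) (hamming≡0⇒≡ u v eq) (proj₁ star)
  fixesStar⇒fixes {u} v (suc k) eq star with hamming-suc⇒flipBit u v k eq
  ... | i , i<n , eq′ = fixesStar⇒fixes v k eq′ (fixesStar-flipBit i i<n star)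

  fixes-units⇒identity : Fixes σ zeros → (∀ i → i < n → Fixes σ (unit i)) → ∀ v → Fixes σ v
  fixes-units⇒identity fixed fixedᵤ v = fixesStar⇒fixes v _ refl (fixed , fixedᵤ)

Preserves : ∀ {n k} → Automorphism n → (V n → Fin k) → Set
Preserves σ c = ∀ v → c (to σ v) ≡ c v

⁻¹-preserves : ∀ {n k} {σ : Automorphism n} {c : V n → Fin k} → Preserves σ c → Preserves (σ ⁻¹) c
⁻¹-preserves {σ = σ} {c} preserves v = trans (sym (preserves (from σ v))) (cong c (to-from σ v))

injective⇒distinguishing : ∀ {n k} (c : V n → Fin k) → (∀ {u v} → c u ≡ c v → u ≡ v) →
                           Distinguishing n k c
injective⇒distinguishing c c-injective σ preserves v = c-injective (preserves v)

moves⇒¬distinguishing : ∀ {n k} {c : V n → Fin k} (σ : Automorphism n) → Preserves σ c →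
                        ∀ v → to σ v ≢ v → ¬ Distinguishing n k c
moves⇒¬distinguishing σ preserves v moved distinguishing = moved (distinguishing σ preserves v)

at-least-two-colours : ∀ {n} → 1 ≤ n → ∀ k → k < 2 → (c : V n → Fin k) → ¬ Distinguishing n k c
at-least-two-colours {suc n} _ 0 _ c with () ← c zeros
at-least-two-colours {suc n} _ (suc (suc k)) (s≤s (s≤s ()))
at-least-two-colours {suc n} _ 1 _ c =
  moves⇒¬distinguishing complementᴬ (λ v → Fin1-irrelevant _ _) zeros λ ()
  where
  Fin1-irrelevant : (a b : Fin 1) → a ≡ b
  Fin1-irrelevant zero zero = refl

indicator : ∀ {A : Set} {P : A → Set} → (∀ x → Dec (P x)) → A → Fin 2
indicator P? x with P? x
... | yes _ = suc zero
... | no  _ = zero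

indicator-transfer : ∀ {A : Set} {P : A → Set} (P? : ∀ x → Dec (P x)) {x y} →
                     indicator P? x ≡ indicator P? y → P x → P y
indicator-transfer P? {x} {y} eq px with P? x | P? y
... | _      | yes py = py
... | no ¬px | no _   = ⊥-elim (¬px px)
... | yes _  | no _   with () ← eq

module Transposition {n} (a b : V n) (a≢b : a ≢ b) where

  swap : V n → V n
  swap x with x ≟ⱽ a | x ≟ⱽ b
  ... | yes _ | _     = b
  ... | no _  | yes _ = a
  ... | no _  | no _  = x

  swap-a : swap a ≡ b
  swap-a with a ≟ⱽ a
  ... | yes _   = refl
  ... | no a≢a  = ⊥-elim (a≢a refl)

  swap-b : swap b ≡ a
  swap-b with b ≟ⱽ a | b ≟ⱽ b
  ... | yes b≡a | _      = ⊥-elim (a≢b (sym b≡a))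
  ... | no _    | yes _  = refl
  ... | no _    | no b≢b = ⊥-elim (b≢b refl)

  swap-other : ∀ {x} → x ≢ a → x ≢ b → swap x ≡ x
  swap-other {x} x≢a x≢b with x ≟ⱽ a | x ≟ⱽ b
  ... | yes x≡a | _       = ⊥-elim (x≢a x≡a)
  ... | no _    | yes x≡b = ⊥-elim (x≢b x≡b)
  ... | no _    | no _    = refl

  position : ∀ x → x ≡ a ⊎ x ≡ b ⊎ (x ≢ a × x ≢ b)
  position x with x ≟ⱽ a | x ≟ⱽ b
  ... | yes x≡a | _       = inj₁ x≡a
  ... | no _    | yes x≡b = inj₂ (inj₁ x≡b)
  ... | no x≢a  | no x≢b  = inj₂ (inj₂ (x≢a , x≢b))

  swap-invariant : ∀ {A : Set} (f : V n → A) → f a ≡ f b → ∀ x → f (swap x) ≡ f x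
  swap-invariant f fa≡fb x with position x
  ... | inj₁ refl                = trans (cong f swap-a) (sym fa≡fb)
  ... | inj₂ (inj₁ refl)         = trans (cong f swap-b) fa≡fb
  ... | inj₂ (inj₂ (x≢a , x≢b)) = cong f (swap-other x≢a x≢b)

  swap-involutive : ∀ x → swap (swap x) ≡ x
  swap-involutive x with position x
  ... | inj₁ refl                = trans (cong swap swap-a) swap-b
  ... | inj₂ (inj₁ refl)         = trans (cong swap swap-b) swap-a
  ... | inj₂ (inj₂ (x≢a , x≢b)) = trans (cong swap (swap-other x≢a x≢b)) (swap-other x≢a x≢b)

  swap-injective : ∀ {x y} → swap x ≡ swap y → x ≡ y
  swap-injective {x} {y} eq = trans (sym (swap-involutive x)) (trans (cong swap eq) (swap-involutive y))

  same-colour⇒¬distinguishing : ∀ {k} (c : V n → Fin k) → c a ≡ c b →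
                                (∀ u v → Adj n u v → Adj n (swap u) (swap v)) →
                                ¬ Distinguishing n k c
  same-colour⇒¬distinguishing c ca≡cb swap-adj =
    moves⇒¬distinguishing (involution swap swap-involutive swap-adj) (swap-invariant c ca≡cb) a
      (λ swap-a≡a → a≢b (trans (sym swap-a≡a) swap-a))

Unique-lookup-injective : ∀ {A : Set} {xs : List A} {i j} → Unique xs → lookup xs i ≡ lookup xs j → i ≡ j
Unique-lookup-injective {xs = x ∷ xs} {zero}  {zero}  _            _  = refl
Unique-lookup-injective {xs = x ∷ xs} {zero}  {suc j} (x∉xs ∷ _)   eq =
  ⊥-elim (All.lookup x∉xs (∈-lookup j) eq)
Unique-lookup-injective {xs = x ∷ xs} {suc i} {zero}  (x∉xs ∷ _)   eq =
  ⊥-elim (All.lookup x∉xs (∈-lookup i) (sym eq))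
Unique-lookup-injective {xs = x ∷ xs} {suc i} {suc j} (_ ∷ unique) eq = cong suc (Unique-lookup-injective unique eq)

Unique-⊆⇒length≤ : ∀ {A : Set} {xs ys : List A} → Unique xs → (∀ {x} → x ∈ xs → x ∈ ys) →
                   length xs ≤ length ys
Unique-⊆⇒length≤ {A} {xs} {ys} unique xs⊆ys = ≮⇒≥ λ ys<xs →
  let i , j , i<j , eq = Fin.pigeonhole ys<xs (λ i → Any.index (xs⊆ys (∈-lookup i))) in
  Fin.<-irrefl (Unique-lookup-injective unique
    (Membership.index-injective (setoid A) (xs⊆ys (∈-lookup i)) (xs⊆ys (∈-lookup j)) eq)) i<j

injective⇒surjective : ∀ {k m} (f : Fin k → Fin m) → m ≤ k → (∀ {i j} → f i ≡ f j → i ≡ j) →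
                       ∀ y → ∃ λ i → f i ≡ y
injective⇒surjective {m = suc m} f m≤k f-injective y with Fin.any? (λ i → f i Fin.≟ y)
... | yes hit = hit
... | no miss =
  let i , j , i<j , eq = Fin.pigeonhole m≤k (λ i → punchOut (y≢f i)) in
  ⊥-elim (Fin.<-irrefl (f-injective (Fin.punchOut-injective (y≢f i) (y≢f j) eq)) i<j)
  where
  y≢f : ∀ i → y ≢ f i
  y≢f i y≡fi = miss (i , sym y≡fi)

-- n ≤ 2: FQ_n is the complete graph on 2ⁿ vertices

bitIndex : Bool → Fin 2
bitIndex false = zero
bitIndex true  = suc zero

bitOf : Fin 2 → Bool
bitOf zero       = false
bitOf (suc zero) = true

bitIndex-injective : ∀ {a b} → bitIndex a ≡ bitIndex b → a ≡ b
bitIndex-injective {false} {false} _ = refl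
bitIndex-injective {true}  {true}  _ = refl

bitIndex-bitOf : ∀ i → bitIndex (bitOf i) ≡ i
bitIndex-bitOf zero       = refl
bitIndex-bitOf (suc zero) = refl

index : ∀ {n} → V n → Fin (2 ^ n)
index []       = zero
index (x ∷ xs) = combine (bitIndex x) (index xs)

vertex : ∀ {n} → Fin (2 ^ n) → V n
vertex {zero}  _ = []
vertex {suc n} i = bitOf (proj₁ (remQuot {2} (2 ^ n) i)) ∷ vertex (proj₂ (remQuot {2} (2 ^ n) i))

index-injective : ∀ {n} {u v : V n} → index u ≡ index v → u ≡ v
index-injective {u = []}     {[]}     _  = refl
index-injective {u = x ∷ xs} {y ∷ ys} eq with combine-injective (bitIndex x) (index xs) (bitIndex y) (index ys) eq
... | x≡y , xs≡ys = cong₂ _∷_ (bitIndex-injective x≡y) (index-injective xs≡ys)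

index-vertex : ∀ {n} (i : Fin (2 ^ n)) → index (vertex {n} i) ≡ i
index-vertex {zero}  zero = refl
index-vertex {suc n} i    = trans
  (cong₂ combine (bitIndex-bitOf (proj₁ (remQuot {2} (2 ^ n) i))) (index-vertex {n} (proj₂ (remQuot {2} (2 ^ n) i))))
  (combine-remQuot {2} (2 ^ n) i)

Adj⇔≢ : ∀ {n} (u v : V n) → 1 ≤ n → n ≤ 2 → Adj n u v ⇔ u ≢ v
Adj⇔≢ {n} u v 1≤n n≤2 =
  mk⇔ (λ { a refl → Adj-irrefl u 1≤n a }) (λ u≢v → adjacent (hamming≤n u v) u≢v)
  where
  adjacent : hamming u v ≤ n → u ≢ v → Adj n u v
  adjacent h≤n u≢v with hamming u v | hamming≡0⇒≡ u v
  ... | 0                 | ≡0⇒≡ = ⊥-elim (u≢v (≡0⇒≡ refl))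
  ... | 1                 | _    = inj₁ refl
  ... | 2                 | _    = inj₂ (≤-antisym h≤n n≤2)
  ... | suc (suc (suc _)) | _    with s≤s (s≤s ()) ← ≤-trans h≤n n≤2

distNumber-complete : ∀ n → 1 ≤ n → n ≤ 2 → DistNumber n (2 ^ n)
distNumber-complete n 1≤n n≤2 = (index , injective⇒distinguishing index index-injective) , fewer
  where
  fewer : ∀ k → k < 2 ^ n → (c : V n → Fin k) → ¬ Distinguishing n k c
  fewer k k<2ⁿ c with Fin.pigeonhole k<2ⁿ (λ i → c (vertex {n} i))
  ... | i , j , i<j , same-colour =
    same-colour⇒¬distinguishing c same-colour λ u v a →
      Equivalence.from (Adj⇔≢ (swap u) (swap v) 1≤n n≤2)
        (λ eq → Equivalence.to (Adj⇔≢ u v 1≤n n≤2) a (swap-injective eq))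
    where
    vertexᵢ≢vertexⱼ : vertex {n} i ≢ vertex j
    vertexᵢ≢vertexⱼ eq =
      Fin.<-irrefl (trans (sym (index-vertex {n} i)) (trans (cong index eq) (index-vertex {n} j))) i<j
    open Transposition (vertex i) (vertex j) vertexᵢ≢vertexⱼ

-- n = 3: FQ₃ is the complete bipartite graph K₄,₄ between the two parity classes

parity : ∀ {n} → V n → Bool
parity []       = false
parity (x ∷ xs) = x xor parity xs

odd : ℕ → Bool
odd zero    = false
odd (suc n) = not (odd n)

xor-interchange : ∀ a b c d → (a xor b) xor (c xor d) ≡ (a xor c) xor (b xor d)
xor-interchange false _ false _ = refl
xor-interchange true  b false d = sym (not-distribˡ-xor b d)
xor-interchange false b true  d = sym (not-distribʳ-xor b d)
xor-interchange true  b true  d = xor-annihilates-not b d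

≡false⇔⇒≡ : ∀ {a b} → (a ≡ false ⇔ b ≡ false) → a ≡ b
≡false⇔⇒≡ {false} {false} _   = refl
≡false⇔⇒≡ {true}  {true}  _   = refl
≡false⇔⇒≡ {false} {true}  a⇔b = sym (Equivalence.to a⇔b refl)
≡false⇔⇒≡ {true}  {false} a⇔b = Equivalence.from a⇔b refl

xor-cancelʳ : ∀ a b → (a xor b) xor b ≡ a
xor-cancelʳ a b = trans (xor-assoc a b b) (trans (cong (a xor_) (xor-same b)) (xor-identityʳ a))

parity-hamming : ∀ {n} (u v : V n) → parity u xor parity v ≡ odd (hamming u v)
parity-hamming []       []       = refl
parity-hamming (x ∷ xs) (y ∷ ys) = begin
  (x xor parity xs) xor (y xor parity ys) ≡⟨ xor-interchange x (parity xs) y (parity ys) ⟩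
  (x xor y) xor (parity xs xor parity ys) ≡⟨ cong ((x xor y) xor_) (parity-hamming xs ys) ⟩
  (x xor y) xor odd (hamming xs ys)       ≡⟨ odd-+ (x xor y) (hamming xs ys) ⟨
  odd (hamming (x ∷ xs) (y ∷ ys))         ∎
  where
  open ≡-Reasoning
  odd-+ : ∀ b h → odd ((if b then 1 else 0) + h) ≡ b xor odd h
  odd-+ true  _ = refl
  odd-+ false _ = refl

Adj₃⇔parity : (u v : V 3) → Adj 3 u v ⇔ (parity u xor parity v ≡ true)
Adj₃⇔parity u v rewrite parity-hamming u v =
  mk⇔ (adjacent⇒odd (hamming u v)) (odd⇒adjacent (hamming u v) (hamming≤n u v))
  where
  adjacent⇒odd : ∀ h → h ≡ 1 ⊎ h ≡ 3 → odd h ≡ true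
  adjacent⇒odd _ (inj₁ refl) = refl
  adjacent⇒odd _ (inj₂ refl) = refl
  odd⇒adjacent : ∀ h → h ≤ 3 → odd h ≡ true → h ≡ 1 ⊎ h ≡ 3
  odd⇒adjacent 1 _ _ = inj₁ refl
  odd⇒adjacent 3 _ _ = inj₂ refl
  odd⇒adjacent (suc (suc (suc (suc _)))) (s≤s (s≤s (s≤s ()))) _

parity-invariant⇒Adj₃ : (f : V 3 → V 3) → (∀ u v → parity (f u) xor parity (f v) ≡ parity u xor parity v) →
                        ∀ u v → Adj 3 u v → Adj 3 (f u) (f v)
parity-invariant⇒Adj₃ f invariant u v a =
  Equivalence.from (Adj₃⇔parity (f u) (f v)) (trans (invariant u v) (Equivalence.to (Adj₃⇔parity u v) a))

withParity : ∀ {n} → Bool → V n → V (suc n)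
withParity b v = (b xor parity v) ∷ v

parity-withParity : ∀ {n} b (v : V n) → parity (withParity b v) ≡ b
parity-withParity b v = xor-cancelʳ b (parity v)

withParity-tail : ∀ {n} (v : V (suc n)) → withParity (parity v) (tail v) ≡ v
withParity-tail (x ∷ xs) = cong (_∷ xs) (xor-cancelʳ x (parity xs))

colour₃ : V 3 → Fin 5
colour₃ v with v ≟ⱽ ones
... | yes _ = fromℕ 4
... | no  _ = inject₁ (index (tail v))

colour₃≡4⇒ones : ∀ {v} → colour₃ v ≡ fromℕ 4 → v ≡ ones
colour₃≡4⇒ones {v} eq with v ≟ⱽ ones
... | yes v≡ones = v≡ones
... | no  _      = ⊥-elim (Fin.fromℕ≢inject₁ (sym eq))

colour₃-injective-on-parity-classes : ∀ {u v} → parity u ≡ parity v → colour₃ u ≡ colour₃ v → u ≡ v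
colour₃-injective-on-parity-classes {u} {v} same-parity same-colour with u ≟ⱽ ones | v ≟ⱽ ones
... | yes u≡ones | yes v≡ones = trans u≡ones (sym v≡ones)
... | yes _      | no  _      = ⊥-elim (Fin.fromℕ≢inject₁ same-colour)
... | no  _      | yes _      = ⊥-elim (Fin.fromℕ≢inject₁ (sym same-colour))
... | no  _      | no  _      = begin
  u                               ≡⟨ withParity-tail u ⟨
  withParity (parity u) (tail u)  ≡⟨ cong₂ withParity same-parity same-tail ⟩
  withParity (parity v) (tail v)  ≡⟨ withParity-tail v ⟩
  v                               ∎
  where
  open ≡-Reasoning
  same-tail : tail u ≡ tail v
  same-tail = index-injective (Fin.inject₁-injective same-colour)

-- The colour class {ones} is fixed; adjacency to ones then detects the parity.
colour₃-distinguishing : Distinguishing 3 5 colour₃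
colour₃-distinguishing σ preserves v =
  colour₃-injective-on-parity-classes (≡false⇔⇒≡ even⇔even) (preserves v)
  where
  ones-fixed : Fixes σ ones
  ones-fixed = colour₃≡4⇒ones (preserves ones)
  even⇔Adj-ones : ∀ x → parity x ≡ false ⇔ Adj 3 x ones
  even⇔Adj-ones x with parity x | Adj₃⇔parity x ones
  ... | false | adj⇔ = mk⇔ (λ _ → Equivalence.from adj⇔ refl) (λ _ → refl)
  ... | true  | adj⇔ = mk⇔ (λ ()) (λ a → case Equivalence.to adj⇔ a of λ ())
  Adj-ones⇔ : Adj 3 (to σ v) ones ⇔ Adj 3 v ones
  Adj-ones⇔ = ⇔-sym (subst (λ w → Adj 3 v ones ⇔ Adj 3 (to σ v) w) ones-fixed (adj σ v ones))
  even⇔even : parity (to σ v) ≡ false ⇔ parity v ≡ false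
  even⇔even = ⇔-sym (even⇔Adj-ones v) ⇔-∘ (Adj-ones⇔ ⇔-∘ even⇔Adj-ones (to σ v))

-- With at most four colours, equal colours inside a parity class can be
-- swapped, so each class is coloured bijectively; matching colours across the
-- classes then yields a colour-preserving automorphism that exchanges them.
module FewerThanFive {k} (k≤4 : k ≤ 4) (c : V 3 → Fin k) (distinguishing : Distinguishing 3 k c) where

  injective-on-parity-classes : ∀ u v → parity u ≡ parity v → c u ≡ c v → u ≡ v
  injective-on-parity-classes u v same-parity same-colour with u ≟ⱽ v
  ... | yes u≡v = u≡v
  ... | no  u≢v = ⊥-elim (same-colour⇒¬distinguishing c same-colour
                    (parity-invariant⇒Adj₃ swap λ x y →
                      cong₂ _xor_ (swap-invariant parity same-parity x) (swap-invariant parity same-parity y))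
                    distinguishing)
    where open Transposition u v u≢v

  class : Bool → Fin 4 → V 3
  class b i = withParity b (vertex {2} i)

  class-colour-injective : ∀ b {i j} → c (class b i) ≡ c (class b j) → i ≡ j
  class-colour-injective b {i} {j} same-colour =
    trans (sym (index-vertex {2} i)) (trans (cong (index ∘ tail) same-vertex) (index-vertex {2} j))
    where
    same-vertex : class b i ≡ class b j
    same-vertex = injective-on-parity-classes _ _
      (trans (parity-withParity b (vertex {2} i)) (sym (parity-withParity b (vertex {2} j)))) same-colour

  match : ∀ x → ∃ λ i → c (class (not (parity x)) i) ≡ c x
  match x = injective⇒surjective _ k≤4 (class-colour-injective (not (parity x))) (c x)

  partner : V 3 → V 3
  partner x = class (not (parity x)) (proj₁ (match x))

  partner-colour : ∀ x → c (partner x) ≡ c x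
  partner-colour x = proj₂ (match x)

  partner-parity : ∀ x → parity (partner x) ≡ not (parity x)
  partner-parity x = parity-withParity (not (parity x)) (vertex {2} (proj₁ (match x)))

  partner-involutive : ∀ x → partner (partner x) ≡ x
  partner-involutive x = injective-on-parity-classes _ _
    (trans (partner-parity (partner x)) (trans (cong not (partner-parity x)) (not-involutive (parity x))))
    (trans (partner-colour (partner x)) (partner-colour x))

  partnerᴬ : Automorphism 3
  partnerᴬ = involution partner partner-involutive (parity-invariant⇒Adj₃ partner λ u v →
    trans (cong₂ _xor_ (partner-parity u) (partner-parity v)) (xor-annihilates-not (parity u) (parity v)))

  impossible : ⊥
  impossible = moves⇒¬distinguishing partnerᴬ partner-colour zeros
    (λ fixed → not-≢ _ (trans (sym (partner-parity zeros)) (cong parity fixed)))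
    distinguishing

distNumber₃ : DistNumber 3 5
distNumber₃ = (colour₃ , colour₃-distinguishing) , λ k k<5 c → FewerThanFive.impossible (≤-pred k<5) c

-- n ≥ 4: a distinguishing 2-colouring

unitPair : ∀ {n} → ℕ → V n
unitPair k = flipBit (suc k) (unit k)

bit-unit : ∀ {n} i → i < n → bit (unit {n} i) i ≡ true
bit-unit {n} i i<n = trans (bit-flipBit i zeros i<n) (cong not (bit-zeros {n} i))

bit-unit-≢ : ∀ {n} i j → i ≢ j → bit (unit {n} i) j ≡ false
bit-unit-≢ {n} i j i≢j = trans (bit-flipBit-≢ i j (zeros {n}) i≢j) (bit-zeros {n} j)

bit-unitPair-≢ : ∀ {n} k p → k ≢ p → suc k ≢ p → bit (unitPair {n} k) p ≡ false
bit-unitPair-≢ {n} k p k≢p sk≢p = trans (bit-flipBit-≢ (suc k) p (unit {n} k) sk≢p) (bit-unit-≢ {n} k p k≢p)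

weight-unit : ∀ {n} i → i < n → weight (unit {n} i) ≡ 1
weight-unit {n} i i<n = trans (weight-flipBit-false i zeros i<n (bit-zeros {n} i)) (cong suc (weight-zeros {n}))

weight-unitPair : ∀ {n} k → suc k < n → weight (unitPair {n} k) ≡ 2
weight-unitPair {n} k k<n = trans
  (weight-flipBit-false (suc k) (unit k) k<n (bit-unit-≢ {n} k (suc k) (<⇒≢ (n<1+n k))))
  (cong suc (weight-unit k (<-trans (n<1+n k) k<n)))

flipBit-unit : ∀ {n} i → flipBit i (unit {n} i) ≡ zeros
flipBit-unit {n} i = flipBit-involutive i (zeros {n})

flipBit-unitPair : ∀ {n} k → flipBit k (unitPair {n} k) ≡ unit (suc k)
flipBit-unitPair {n} k = trans (cong (flipBit k) (flipBit-comm (suc k) k (zeros {n}))) (flipBit-involutive k _)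

unitPair-support : ∀ {n} a b p q → b < n → a ≢ b →
                   flipBit a (unit {n} b) ≡ flipBit p (unit q) → b ≡ p ⊎ b ≡ q
unitPair-support {n} a b p q b<n a≢b eq with b ≟ p | b ≟ q
... | yes b≡p | _       = inj₁ b≡p
... | no _    | yes b≡q = inj₂ b≡q
... | no b≢p  | no b≢q  = ⊥-elim (not-≢ false (begin
  true                           ≡⟨ bit-unit b b<n ⟨
  bit (unit {n} b) b             ≡⟨ bit-flipBit-≢ a b (unit {n} b) a≢b ⟨
  bit (flipBit a (unit {n} b)) b ≡⟨ cong (λ w → bit w b) eq ⟩
  bit (flipBit p (unit {n} q)) b ≡⟨ bit-flipBit-≢ p b (unit {n} q) (≢-sym b≢p) ⟩
  bit (unit {n} q) b             ≡⟨ bit-unit-≢ {n} q b (≢-sym b≢q) ⟩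
  false                          ∎))
  where open ≡-Reasoning

unitPair-suc-≢ : ∀ {n} k → k < n → unitPair {n} (suc k) ≢ unitPair k
unitPair-suc-≢ k k<n eq with unitPair-support (suc k) k (suc (suc k)) (suc k) k<n (≢-sym (<⇒≢ (n<1+n k))) (sym eq)
... | inj₁ k≡2+k = <⇒≢ (<-trans (n<1+n k) (n<1+n (suc k))) k≡2+k
... | inj₂ k≡1+k = <⇒≢ (n<1+n k) k≡1+k

-- Here n = m + 1, and unit i, unitPair i are eᵢ, eᵢ + eᵢ₊₁.  Leaving e_m
-- unmarked breaks the reversal symmetry of the marked path e₀, e₀ + e₁, e₁, …
module Marking {m} (3≤m : 3 ≤ m) where

  private
    n : ℕ
    n = suc m

    4≤n : 4 ≤ n
    4≤n = s≤s 3≤m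

    <m⇒<n : ∀ {i} → i < m → i < n
    <m⇒<n = m≤n⇒m≤1+n

    0<n : 0 < n
    0<n = s≤s z≤n

    1<n : 1 < n
    1<n = ≤-trans (s≤s (s≤s z≤n)) 4≤n

    2<n : 2 < n
    2<n = ≤-trans (s≤s (s≤s (s≤s z≤n))) 4≤n

    0<m : 0 < m
    0<m = ≤-trans (s≤s z≤n) 3≤m

    1<m : 1 < m
    1<m = ≤-trans (s≤s (s≤s z≤n)) 3≤m

  Marked : V n → Set
  Marked v = v ≡ zeros ⊎ v ≡ ones ⊎ (∃ λ i → i < m × v ≡ unit i) ⊎ (∃ λ i → i < m × v ≡ unitPair i)

  marked? : ∀ v → Dec (Marked v)
  marked? v = v ≟ⱽ zeros ⊎-dec v ≟ⱽ ones
    ⊎-dec anyUpTo? (λ i → v ≟ⱽ unit i) m ⊎-dec anyUpTo? (λ i → v ≟ⱽ unitPair i) m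

  marking : V n → Fin 2
  marking = indicator marked?

  unit-marked : ∀ {i} → i < m → Marked (unit i)
  unit-marked {i} i<m = inj₂ (inj₂ (inj₁ (i , i<m , refl)))

  unitPair-marked : ∀ {i} → i < m → Marked (unitPair i)
  unitPair-marked {i} i<m = inj₂ (inj₂ (inj₂ (i , i<m , refl)))

  marked-weight : ∀ {v} → Marked v → weight v ≡ 0 ⊎ weight v ≡ n ⊎ weight v ≡ 1 ⊎ weight v ≡ 2
  marked-weight (inj₁ refl)                          = inj₁ (weight-zeros {n})
  marked-weight (inj₂ (inj₁ refl))                   = inj₂ (inj₁ (weight-ones {n}))
  marked-weight (inj₂ (inj₂ (inj₁ (i , i<m , refl)))) = inj₂ (inj₂ (inj₁ (weight-unit {n} i (<m⇒<n i<m))))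
  marked-weight (inj₂ (inj₂ (inj₂ (i , i<m , refl)))) = inj₂ (inj₂ (inj₂ (weight-unitPair {n} i (s≤s i<m))))

  weight-3⇒unmarked : ∀ {v} → weight v ≡ 3 → ¬ Marked v
  weight-3⇒unmarked {v} w≡3 marked with weight v | w≡3 | marked-weight marked
  ... | _ | refl | inj₁ ()
  ... | _ | refl | inj₂ (inj₁ 3≡n) = <⇒≢ 4≤n 3≡n
  ... | _ | refl | inj₂ (inj₂ (inj₁ ()))
  ... | _ | refl | inj₂ (inj₂ (inj₂ ()))

  weight-pred-n⇒unmarked : ∀ {v} → suc (weight v) ≡ n → ¬ Marked v
  weight-pred-n⇒unmarked {v} w≡m marked with weight v | suc-injective w≡m | marked-weight marked
  ... | _ | refl | inj₁ m≡0               = <⇒≢ 0<m (sym m≡0)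
  ... | _ | refl | inj₂ (inj₁ m≡n)        = <⇒≢ (n<1+n m) m≡n
  ... | _ | refl | inj₂ (inj₂ (inj₁ m≡1)) = <⇒≢ 1<m (sym m≡1)
  ... | _ | refl | inj₂ (inj₂ (inj₂ m≡2)) = <⇒≢ 3≤m (sym m≡2)

  marked-weight-2 : ∀ {v} → Marked v → weight v ≡ 2 → ∃ λ i → i < m × v ≡ unitPair i
  marked-weight-2 (inj₁ refl) w≡2 with () ← trans (sym (weight-zeros {n})) w≡2
  marked-weight-2 (inj₂ (inj₁ refl)) w≡2 = ⊥-elim (<⇒≢ 2<n (trans (sym w≡2) (weight-ones {n})))
  marked-weight-2 (inj₂ (inj₂ (inj₁ (i , i<m , refl)))) w≡2
    with () ← trans (sym (weight-unit {n} i (<m⇒<n i<m))) w≡2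
  marked-weight-2 (inj₂ (inj₂ (inj₂ pair))) _ = pair

  marked-unit : ∀ {i} → i < n → Marked (unit i) → i < m
  marked-unit {i} i<n (inj₁ eq) with () ← trans (sym (weight-unit {n} i i<n)) (trans (cong weight eq) (weight-zeros {n}))
  marked-unit {i} i<n (inj₂ (inj₁ eq)) =
    ⊥-elim (<⇒≢ 1<n (trans (sym (weight-unit {n} i i<n)) (trans (cong weight eq) (weight-ones {n}))))
  marked-unit {i} i<n (inj₂ (inj₂ (inj₁ (j , j<m , eq)))) =
    subst (_< m) (sym (flipBit-injectiveˡ i j zeros i<n eq)) j<m
  marked-unit {i} i<n (inj₂ (inj₂ (inj₂ (j , j<m , eq)))) with () ←
    trans (sym (weight-unit {n} i i<n)) (trans (cong weight eq) (weight-unitPair {n} j (s≤s j<m)))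

  MarkedNeighboursIn : V n → List (V n) → Set
  MarkedNeighboursIn w L = ∀ {x} → Marked x → Adj n w x → x ∈ L

  unitPairBelow : ℕ → List (V n)
  unitPairBelow zero    = []
  unitPairBelow (suc j) = unitPair j ∷ []

  markedNeighboursOfUnit : ℕ → List (V n)
  markedNeighboursOfUnit k = zeros ∷ unitPair k ∷ unitPairBelow k

  markedNeighbour-zeros : ∀ {x} → Marked x → Adj n zeros x → x ≡ ones ⊎ ∃ λ i → i < m × x ≡ unit i
  markedNeighbour-zeros {x} marked a with neighbours zeros x a
  ... | inj₂ refl              = inj₁ complement-zeros
  ... | inj₁ (i , i<n , refl) = inj₂ (i , marked-unit i<n marked , refl)

  markedNeighbour-ones : ∀ {x} → Marked x → Adj n ones x → x ≡ zeros
  markedNeighbour-ones {x} marked a with neighbours ones x a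
  ... | inj₂ refl              = complement-ones
  ... | inj₁ (i , i<n , refl) = ⊥-elim (weight-pred-n⇒unmarked
      (trans (weight-flipBit-true i ones i<n (bit-ones i i<n)) (weight-ones {n})) marked)

  markedNeighbours-unit : ∀ {k} → k < m → MarkedNeighboursIn (unit k) (markedNeighboursOfUnit k)
  markedNeighbours-unit {k} k<m {x} marked a with neighbours (unit k) x a
  ... | inj₂ refl = ⊥-elim (weight-pred-n⇒unmarked (trans (+-comm 1 _)
      (subst (λ w → weight (complement (unit {n} k)) + w ≡ n) (weight-unit {n} k (<m⇒<n k<m))
             (weight-complement (unit {n} k)))) marked)
  ... | inj₁ (p , p<n , refl) with p ≟ k
  ...   | yes refl = here (flipBit-unit p)
  ...   | no  p≢k with marked-weight-2 marked
                     (trans (weight-flipBit-false p (unit k) p<n (bit-unit-≢ {n} k p (≢-sym p≢k)))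
                            (cong suc (weight-unit {n} k (<m⇒<n k<m))))
  ...     | j , _ , eq with unitPair-support p k (suc j) j (<m⇒<n k<m) p≢k eq
  ...       | inj₁ refl = there (there (here eq))
  ...       | inj₂ refl = there (here eq)

  markedNeighbours-unitPair : ∀ {k} → k < m →
    MarkedNeighboursIn (unitPair k) (unit k ∷ unit (suc k) ∷ complement (unitPair k) ∷ [])
  markedNeighbours-unitPair {k} k<m {x} marked a with neighbours (unitPair k) x a
  ... | inj₂ refl = there (there (here refl))
  ... | inj₁ (p , p<n , refl) with p ≟ suc k | p ≟ k
  ...   | yes refl | _        = here (flipBit-involutive (suc k) (unit k))
  ...   | no _     | yes refl = there (here (flipBit-unitPair k))
  ...   | no p≢1+k | no p≢k   = ⊥-elim (weight-3⇒unmarked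
      (trans (weight-flipBit-false p (unitPair k) p<n (bit-unitPair-≢ {n} k p (≢-sym p≢k) (≢-sym p≢1+k)))
             (cong suc (weight-unitPair {n} k (s≤s k<m)))) marked)

  markedNeighboursOfUnit-length : ∀ k → length (markedNeighboursOfUnit k) ≤ 3
  markedNeighboursOfUnit-length zero    = s≤s (s≤s z≤n)
  markedNeighboursOfUnit-length (suc _) = ≤-refl

  zeros≢unitPair : ∀ {k} → k < m → zeros {n} ≢ unitPair k
  zeros≢unitPair {k} k<m eq
    with () ← trans (sym (weight-zeros {n})) (trans (cong weight eq) (weight-unitPair {n} k (s≤s k<m)))

  unit-≢ : ∀ i j → i < n → i ≢ j → unit {n} i ≢ unit j
  unit-≢ i j i<n i≢j eq = i≢j (flipBit-injectiveˡ i j zeros i<n eq)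

  unit≢ones : ∀ {i} → i < n → unit {n} i ≢ ones
  unit≢ones {i} i<n eq =
    <⇒≢ 1<n (trans (sym (weight-unit {n} i i<n)) (trans (cong weight eq) (weight-ones {n})))

  markedNeighboursOfUnit-unique : ∀ {k} → k < m → Unique (markedNeighboursOfUnit k)
  markedNeighboursOfUnit-unique {zero}  k<m   = (zeros≢unitPair k<m ∷ []) ∷ [] ∷ []
  markedNeighboursOfUnit-unique {suc j} 1+j<m =
    (zeros≢unitPair 1+j<m ∷ zeros≢unitPair (<-trans (n<1+n j) 1+j<m) ∷ [])
    ∷ (unitPair-suc-≢ j (<-trans (n<1+n j) (<m⇒<n 1+j<m)) ∷ []) ∷ [] ∷ []

  markedNeighboursOfUnit-adjacent : ∀ {k} → k < m →
                                    All (λ y → Marked y × Adj n (unit k) y) (markedNeighboursOfUnit k)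
  markedNeighboursOfUnit-adjacent {k} k<m =
    (inj₁ refl , subst (Adj n (unit k)) (flipBit-unit k) (Adj-flipBit k (unit k) (<m⇒<n k<m)))
    ∷ (unitPair-marked k<m , Adj-flipBit (suc k) (unit k) (s≤s k<m))
    ∷ below k k<m
    where
    below : ∀ k → k < m → All (λ y → Marked y × Adj n (unit k) y) (unitPairBelow k)
    below zero    _     = []
    below (suc j) 1+j<m =
      (unitPair-marked (<-trans (n<1+n j) 1+j<m) ,
       subst (Adj n (unit (suc j))) (flipBit-comm j (suc j) zeros)
             (Adj-flipBit j (unit (suc j)) (<-trans (n<1+n j) (<m⇒<n 1+j<m))))
      ∷ []

  fourMarkedNeighboursOfZeros : List (V n)
  fourMarkedNeighboursOfZeros = unit 0 ∷ unit 1 ∷ unit 2 ∷ ones ∷ []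

  fourMarkedNeighboursOfZeros-unique : Unique fourMarkedNeighboursOfZeros
  fourMarkedNeighboursOfZeros-unique =
    (unit-≢ 0 1 0<n (λ ()) ∷ unit-≢ 0 2 0<n (λ ()) ∷ unit≢ones 0<n ∷ [])
    ∷ (unit-≢ 1 2 1<n (λ ()) ∷ unit≢ones 1<n ∷ [])
    ∷ (unit≢ones 2<n ∷ []) ∷ [] ∷ []

  fourMarkedNeighboursOfZeros-adjacent : All (λ y → Marked y × Adj n zeros y) fourMarkedNeighboursOfZeros
  fourMarkedNeighboursOfZeros-adjacent =
    (unit-marked 0<m , Adj-flipBit 0 zeros 0<n)
    ∷ (unit-marked 1<m , Adj-flipBit 1 zeros (<m⇒<n 1<m))
    ∷ (unit-marked 3≤m , Adj-flipBit 2 zeros (<m⇒<n 3≤m))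
    ∷ (inj₂ (inj₁ refl) , subst (Adj n zeros) complement-zeros (Adj-complement zeros))
    ∷ []

  module _ (τ : Automorphism n) (preserves : Preserves τ marking) where

    marked-image : ∀ {v} → Marked v → Marked (to τ v)
    marked-image {v} = indicator-transfer marked? (sym (preserves v))

    markedNeighbours-length : ∀ {v w ys L} → to τ v ≡ w → Unique ys → All (λ y → Marked y × Adj n v y) ys →
                              MarkedNeighboursIn w L → length ys ≤ length L
    markedNeighbours-length {ys = ys} {L} refl unique adjacent cover =
      subst (_≤ length L) (length-map (to τ) ys)
        (Unique-⊆⇒length≤ (Uniqueₚ.map⁺ (to-injective τ) unique) image⊆L)
      where
      image⊆L : ∀ {x} → x ∈ List.map (to τ) ys → x ∈ L
      image⊆L x∈ with ∈-map⁻ (to τ) x∈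
      ... | y , y∈ys , refl with All.lookup adjacent y∈ys
      ...   | marked , a = cover (marked-image marked) (Adj-to τ a)

  module _ (σ : Automorphism n) (preserves : Preserves σ marking) where

    private
      4≰3 : ¬ 4 ≤ 3
      4≰3 = <-irrefl refl

    zeros-image-has-four-marked-neighbours : ∀ {w L} → to σ zeros ≡ w → MarkedNeighboursIn w L → 4 ≤ length L
    zeros-image-has-four-marked-neighbours eq = markedNeighbours-length σ preserves eq
      fourMarkedNeighboursOfZeros-unique fourMarkedNeighboursOfZeros-adjacent

    zeros-fixed : Fixes σ zeros
    zeros-fixed with marked-image σ preserves {zeros} (inj₁ refl)
    ... | inj₁ fixed = fixed
    ... | inj₂ (inj₁ eq) = ⊥-elim (4≰3 (≤-trans
      (zeros-image-has-four-marked-neighbours {L = zeros ∷ []} eq (λ marked a → here (markedNeighbour-ones marked a)))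
      (s≤s z≤n)))
    ... | inj₂ (inj₂ (inj₁ (k , k<m , eq))) = ⊥-elim (4≰3 (≤-trans
      (zeros-image-has-four-marked-neighbours eq (markedNeighbours-unit k<m)) (markedNeighboursOfUnit-length k)))
    ... | inj₂ (inj₂ (inj₂ (k , k<m , eq))) = ⊥-elim (4≰3
      (zeros-image-has-four-marked-neighbours eq (markedNeighbours-unitPair k<m)))

    to≡zeros⇒≡zeros : ∀ {x} → to σ x ≡ zeros → x ≡ zeros
    to≡zeros⇒≡zeros eq = to-injective σ (trans eq (sym zeros-fixed))

    -- σ e₀ is a marked neighbour of zeros.  It is not ones, whose only marked
    -- neighbour is zeros, and not some eₚ₊₁, which has more marked neighbours
    -- (zeros, eₚ + eₚ₊₁, eₚ₊₁ + eₚ₊₂) than e₀ has (zeros, e₀ + e₁).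
    unit0-fixed : Fixes σ (unit 0)
    unit0-fixed with markedNeighbour-zeros (marked-image σ preserves (unit-marked 0<m))
                       (Adj-to-fixed σ zeros-fixed (Adj-flipBit 0 zeros 0<n))
    ... | inj₂ (zero , _ , eq) = eq
    ... | inj₁ eq = ⊥-elim (zeros≢unitPair 0<m (sym (to≡zeros⇒≡zeros (markedNeighbour-ones
            (marked-image σ preserves (unitPair-marked 0<m))
            (subst (λ z → Adj n z (to σ (unitPair 0))) eq (Adj-to σ (Adj-flipBit 1 (unit 0) (s≤s 0<m))))))))
    ... | inj₂ (suc p , 1+p<m , eq) = ⊥-elim (<-irrefl refl
            (markedNeighbours-length (σ ⁻¹) (⁻¹-preserves {σ = σ} preserves) back
              (markedNeighboursOfUnit-unique 1+p<m) (markedNeighboursOfUnit-adjacent 1+p<m)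
              (markedNeighbours-unit 0<m)))
      where
      back : from σ (unit (suc p)) ≡ unit 0
      back = trans (cong (from σ) (sym eq)) (from-to σ (unit 0))

    unit-fixed : ∀ k → k < n → Fixes σ (unit k)
    unitPair-fixed : ∀ k → k < m → Fixes σ (unitPair k)

    unit-fixed zero    _         = unit0-fixed
    unit-fixed (suc k) (s≤s k<m) = subst (Fixes σ) (flipBit-unitPair k)
      (fixes-flipBit-flipBit σ 4≤n k (suc k) (<m⇒<n k<m) (s≤s k<m) (<⇒≢ (n<1+n k))
        (unit-fixed k (<m⇒<n k<m)) (subst (Fixes σ) (sym (flipBit-unit k)) zeros-fixed) (unitPair-fixed k k<m))

    unitPair-fixed k k<m with markedNeighbours-unit k<m (marked-image σ preserves (unitPair-marked k<m))
                                (Adj-to-fixed σ (unit-fixed k (<m⇒<n k<m)) (Adj-flipBit (suc k) (unit k) (s≤s k<m)))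
    ... | here eq         = ⊥-elim (zeros≢unitPair k<m (sym (to≡zeros⇒≡zeros eq)))
    ... | there (here eq) = eq
    unitPair-fixed (suc j) 1+j<m | there (there (here eq)) =
      ⊥-elim (unitPair-suc-≢ j (<-trans (n<1+n j) (<m⇒<n 1+j<m))
        (to-injective σ (trans eq (sym (unitPair-fixed j (<-trans (n<1+n j) 1+j<m))))))

  marking-distinguishing : Distinguishing n 2 marking
  marking-distinguishing σ preserves =
    fixes-units⇒identity σ 4≤n (zeros-fixed σ preserves) (unit-fixed σ preserves)

distNumber≥4 : ∀ n → 4 ≤ n → DistNumber n 2
distNumber≥4 (suc m) (s≤s 3≤m) = (marking , marking-distinguishing) , at-least-two-colours (s≤s z≤n)
  where open Marking 3≤m

theorem5p7 : DistNumber 1 2 × DistNumber 2 4 × DistNumber 3 5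
               × (∀ n → 4 ≤ n → DistNumber n 2)
theorem5p7 = distNumber-complete 1 ≤-refl (s≤s z≤n)
           , distNumber-complete 2 (s≤s z≤n) ≤-refl
           , distNumber₃
           , distNumber≥4
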